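{- Let $\lambda\in\mathbb{R}$. For every $n\in\mathbb{N}$ (i.e. $n\ge1$), \[ A_{n,\lambda}(t)=\sum_{k=0}^{n-1}\binom{n}{k}A_{k,\lambda}(t)\,(t-1)^{n-k-1}\,\langle 1\rangle_{n-k,\lambda}. \]
   Context: For $\lambda\in\mathbb{R}$, $(y)_{0,\lambda}=1$ and $(y)_{n,\lambda}=y(y-\lambda)\cdots(y-(n-1)\lambda)$ for $n\ge1$; also $\langle y\rangle_{0,\lambda}=1$ and $\langle y\rangle_{n,\lambda}=y(y+\lambda)\cdots(y+(n-1)\lambda)$ for $n\ge1$, so $\langle 1\rangle_{n,\lambda}=1(1+\lambda)\cdots(1+(n-1)\lambda)$. The degenerate Eulerian polynomials $A_{n,\lambda}(t)$ ($n\ge0$) are defined by $\frac{A_{n,\lambda}(t)}{(1-t)^{n+1}}=\sum_{j=0}^{\infty}(j+1)_{n,\lambda}t^{j}$ (as formal power series in $t$). -}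

module Defs where

open import Level using (Level)
open import Data.Nat as ℕ using (ℕ; zero; suc; _∸_)
open import Data.Nat.Combinatorics using (_C_)
open import Algebra.Bundles using (CommutativeRing)

-- Formal power series (and polynomials) over a commutative ring R,
-- represented by their coefficient sequences ℕ → Carrier.
module Series {c ℓ : Level} (R : CommutativeRing c ℓ) where
  open CommutativeRing R

  PS : Set c
  PS = ℕ → Carrier

  fromℕ : ℕ → Carrier
  fromℕ zero    = 0#
  fromℕ (suc n) = 1# + fromℕ n

  sumTo : ℕ → (ℕ → Carrier) → Carrier
  sumTo zero    f = 0#
  sumTo (suc n) f = sumTo n f + f n

  falling : Carrier → Carrier → ℕ → Carrier
  falling y lam zero    = 1#
  falling y lam (suc n) = falling y lam n * (y - fromℕ n * lam)

  rising : Carrier → Carrier → ℕ → Carrier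
  rising y lam zero    = 1#
  rising y lam (suc n) = rising y lam n * (y + fromℕ n * lam)

  const : Carrier → PS
  const a zero    = a
  const a (suc m) = 0#

  X : PS
  X zero          = 0#
  X (suc zero)    = 1#
  X (suc (suc m)) = 0#

  _⊕_ : PS → PS → PS
  (f ⊕ g) m = f m + g m

  _⊝_ : PS → PS → PS
  (f ⊝ g) m = f m - g m

  _⊛_ : PS → PS → PS
  (f ⊛ g) m = sumTo (suc m) (λ i → f i * g (m ∸ i))

  scale : Carrier → PS → PS
  scale a f m = a * f m

  pow : PS → ℕ → PS
  pow f zero    = const 1#
  pow f (suc n) = pow f n ⊛ f

  sumPS : ℕ → (ℕ → PS) → PS
  sumPS n F m = sumTo n (λ k → F k m)

  _≋_ : PS → PS → Set ℓ
  f ≋ g = ∀ m → f m ≈ g m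

  fallingSeries : Carrier → ℕ → PS
  fallingSeries lam n j = falling (fromℕ (suc j)) lam n

  -- degenerate Eulerian polynomial: the unique series with
  -- A_{n,λ}(t) / (1-t)^{n+1} = Σ_j (j+1)_{n,λ} t^j, i.e.
  -- A_{n,λ}(t) = (1-t)^{n+1} · Σ_j (j+1)_{n,λ} t^j
  A : Carrier → ℕ → PS
  A lam n = pow (const 1# ⊝ X) (suc n) ⊛ fallingSeries lam n

  rhs : Carrier → ℕ → PS
  rhs lam n = sumPS n (λ k →
    scale (fromℕ (n C k) * rising 1# lam (n ∸ k))
          (A lam k ⊛ pow (X ⊝ const 1#) (n ∸ k ∸ 1)))

-- One factor (1-t) of A_n = (1-t)^{n+1} Σ_j (j+1)_{n,λ} t^j turns the coefficients into the
-- differences (j+1)_{n,λ} - (j)_{n,λ}. Expanding (j)_{n,λ} = ((j+1) + (-1))_{n,λ} by the degenerate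
-- binomial theorem and using (-1)_{d,λ} = (-1)^d ⟨1⟩_{d,λ}, the difference becomes
-- Σ_{k<n} C(n,k) (-1)^{n-k-1} ⟨1⟩_{n-k,λ} (j+1)_{k,λ}. Each Σ_j (j+1)_{k,λ} t^j is A_k / (1-t)^{k+1},
-- and the leftover (1-t)^{n-k-1} absorbs the sign to become (t-1)^{n-k-1}.
{-# OPTIONS --safe #-}
module Submission where

open import Defs
open import Level using (Level)
open import Data.Nat as ℕ using (ℕ; zero; suc; _≤_; _<_; s≤s; _∸_)
import Data.Nat.Properties as ℕ
open import Data.Nat.Combinatorics using (_C_; nCk+nC[k+1]≡[n+1]C[k+1]; k>n⇒nCk≡0; nCn≡1)
open import Algebra.Bundles using (CommutativeRing)
import Algebra.Properties.AbelianGroup as AbelianGroupProperties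
import Algebra.Properties.CommutativeSemigroup as CommutativeSemigroupProperties
import Algebra.Properties.Group as GroupProperties
import Algebra.Properties.Ring as RingProperties
import Algebra.Properties.Semiring.Exp as SemiringExp
open import Relation.Binary.Bundles using (Setoid)
open import Relation.Binary.PropositionalEquality as ≡ using (_≡_)
import Relation.Binary.Reasoning.Setoid as SetoidReasoning

n∸k≡suc[n∸k∸1] : ∀ {n k} → k < n → n ∸ k ≡ suc (n ∸ k ∸ 1)
n∸k≡suc[n∸k∸1] {suc n} {zero}  _         = ≡.refl
n∸k≡suc[n∸k∸1] {suc n} {suc k} (s≤s k<n) = n∸k≡suc[n∸k∸1] k<n

module RingLemmas {c ℓ : Level} (R : CommutativeRing c ℓ) where
  open CommutativeRing R public
  open Series R using (fromℕ)
  open RingProperties ring public using (-‿distribʳ-*; -1*x≈-x)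
  open GroupProperties +-group public using (ε⁻¹≈ε; ⁻¹-involutive)
  open SemiringExp semiring public using (_^_)
  module +-Props = CommutativeSemigroupProperties +-commutativeSemigroup
  module *-Props = CommutativeSemigroupProperties *-commutativeSemigroup

  -‿distrib-+ : ∀ x y → - (x + y) ≈ - x + - y
  -‿distrib-+ x y = sym (AbelianGroupProperties.⁻¹-∙-comm +-abelianGroup x y)

  fromℕ-+ : ∀ m n → fromℕ (m ℕ.+ n) ≈ fromℕ m + fromℕ n
  fromℕ-+ zero    n = sym (+-identityˡ _)
  fromℕ-+ (suc m) n = trans (+-cong refl (fromℕ-+ m n)) (sym (+-assoc _ _ _))

  x-0≈x : ∀ x → x - 0# ≈ x
  x-0≈x x = trans (+-cong refl ε⁻¹≈ε) (+-identityʳ x)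

  fromℕ-1 : fromℕ 1 ≈ 1#
  fromℕ-1 = +-identityʳ 1#

module FiniteSums {c ℓ : Level} (R : CommutativeRing c ℓ) where
  open RingLemmas R
  open Series R using (sumTo)
  open SetoidReasoning setoid

  sumTo-cong-< : ∀ n {f g : ℕ → Carrier} → (∀ i → i < n → f i ≈ g i) → sumTo n f ≈ sumTo n g
  sumTo-cong-< zero    f≈g = refl
  sumTo-cong-< (suc n) f≈g = +-cong (sumTo-cong-< n (λ i i<n → f≈g i (ℕ.m<n⇒m<1+n i<n))) (f≈g n ℕ.≤-refl)

  sumTo-cong : ∀ n {f g : ℕ → Carrier} → (∀ i → f i ≈ g i) → sumTo n f ≈ sumTo n g
  sumTo-cong n f≈g = sumTo-cong-< n (λ i _ → f≈g i)

  sumTo-≡ : ∀ {m n} (f : ℕ → Carrier) → m ≡ n → sumTo m f ≈ sumTo n f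
  sumTo-≡ f m≡n = reflexive (≡.cong (λ m → sumTo m f) m≡n)

  sumTo-0 : ∀ n {f : ℕ → Carrier} → (∀ i → f i ≈ 0#) → sumTo n f ≈ 0#
  sumTo-0 zero    f≈0 = refl
  sumTo-0 (suc n) f≈0 = trans (+-cong (sumTo-0 n f≈0) (f≈0 n)) (+-identityˡ 0#)

  sumTo-distrib-+ : ∀ n (f g : ℕ → Carrier) → sumTo n (λ i → f i + g i) ≈ sumTo n f + sumTo n g
  sumTo-distrib-+ zero    f g = sym (+-identityˡ 0#)
  sumTo-distrib-+ (suc n) f g = trans (+-cong (sumTo-distrib-+ n f g) refl) (+-Props.interchange _ _ _ _)

  -‿distrib-sumTo : ∀ n (f : ℕ → Carrier) → - sumTo n f ≈ sumTo n (λ i → - f i)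
  -‿distrib-sumTo zero    f = ε⁻¹≈ε
  -‿distrib-sumTo (suc n) f = trans (-‿distrib-+ _ _) (+-cong (-‿distrib-sumTo n f) refl)

  *-distribˡ-sumTo : ∀ n a (f : ℕ → Carrier) → a * sumTo n f ≈ sumTo n (λ i → a * f i)
  *-distribˡ-sumTo zero    a f = zeroʳ a
  *-distribˡ-sumTo (suc n) a f = trans (distribˡ _ _ _) (+-cong (*-distribˡ-sumTo n a f) refl)

  *-distribʳ-sumTo : ∀ n a (f : ℕ → Carrier) → sumTo n f * a ≈ sumTo n (λ i → f i * a)
  *-distribʳ-sumTo zero    a f = zeroˡ a
  *-distribʳ-sumTo (suc n) a f = trans (distribʳ _ _ _) (+-cong (*-distribʳ-sumTo n a f) refl)

  sumTo-head : ∀ n (f : ℕ → Carrier) → sumTo (suc n) f ≈ f 0 + sumTo n (λ i → f (suc i))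
  sumTo-head zero    f = trans (+-identityˡ _) (sym (+-identityʳ _))
  sumTo-head (suc n) f = trans (+-cong (sumTo-head n f) refl) (+-assoc _ _ _)

  sumTo-swap : ∀ m n (F : ℕ → ℕ → Carrier) →
    sumTo m (λ i → sumTo n (F i)) ≈ sumTo n (λ j → sumTo m (λ i → F i j))
  sumTo-swap zero    n F = sym (sumTo-0 n (λ _ → refl))
  sumTo-swap (suc m) n F = trans (+-cong (sumTo-swap m n F) refl)
    (sym (sumTo-distrib-+ n (λ j → sumTo m (λ i → F i j)) (F m)))

  sumTo-reverse : ∀ n (f : ℕ → Carrier) → sumTo n f ≈ sumTo n (λ i → f (n ∸ suc i))
  sumTo-reverse zero    f = refl
  sumTo-reverse (suc n) f = sym (begin
    sumTo (suc n) (λ i → f (n ∸ i))        ≈⟨ sumTo-head n _ ⟩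
    f n + sumTo n (λ i → f (n ∸ suc i))    ≈⟨ +-comm _ _ ⟩
    sumTo n (λ i → f (n ∸ suc i)) + f n    ≈⟨ +-cong (sumTo-reverse n f) refl ⟨
    sumTo (suc n) f                        ∎)

  sumTo-triangle : ∀ n (T : ℕ → ℕ → Carrier) →
    sumTo n (λ k → sumTo (suc k) (λ i → T i k)) ≈ sumTo n (λ i → sumTo (n ∸ i) (λ j → T i (i ℕ.+ j)))
  sumTo-triangle zero    T = refl
  sumTo-triangle (suc n) T = sym (begin
      sumTo (suc n) (λ i → sumTo (suc n ∸ i) (λ j → T i (i ℕ.+ j)))
    ≈⟨ sumTo-cong-< (suc n) peel-last ⟩
      sumTo (suc n) (λ i → sumTo (n ∸ i) (λ j → T i (i ℕ.+ j)) + T i n)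
    ≈⟨ sumTo-distrib-+ (suc n) _ _ ⟩
      (sumTo n (λ i → sumTo (n ∸ i) (λ j → T i (i ℕ.+ j))) + sumTo (n ∸ n) (λ j → T n (n ℕ.+ j)))
        + sumTo (suc n) (λ i → T i n)
    ≈⟨ +-cong (trans (+-cong (sym (sumTo-triangle n T)) (sumTo-≡ _ (ℕ.n∸n≡0 n))) (+-identityʳ _)) refl ⟩
      sumTo n (λ k → sumTo (suc k) (λ i → T i k)) + sumTo (suc n) (λ i → T i n)
    ∎)
    where
    peel-last : ∀ i → i < suc n →
      sumTo (suc n ∸ i) (λ j → T i (i ℕ.+ j)) ≈ sumTo (n ∸ i) (λ j → T i (i ℕ.+ j)) + T i n
    peel-last i (s≤s i≤n) = trans (sumTo-≡ _ (ℕ.+-∸-assoc 1 i≤n))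
      (+-cong refl (reflexive (≡.cong (T i) (ℕ.m+[n∸m]≡n i≤n))))

module PowerSeries {c ℓ : Level} (R : CommutativeRing c ℓ) where
  open RingLemmas R
  open Series R
  open FiniteSums R

  ≋-setoid : Setoid c ℓ
  ≋-setoid = record
    { Carrier       = PS
    ; _≈_           = _≋_
    ; isEquivalence = record
      { refl  = λ _ → refl
      ; sym   = λ f≋g m → sym (f≋g m)
      ; trans = λ f≋g g≋h m → trans (f≋g m) (g≋h m)
      }
    }

  open Setoid ≋-setoid public using () renaming (refl to ≋-refl; trans to ≋-trans)

  1-X X-1 : PS
  1-X = const 1# ⊝ X
  X-1 = X ⊝ const 1#

  ⊛-cong : ∀ {f f′ g g′} → f ≋ f′ → g ≋ g′ → (f ⊛ g) ≋ (f′ ⊛ g′)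
  ⊛-cong f≋f′ g≋g′ m = sumTo-cong (suc m) (λ i → *-cong (f≋f′ i) (g≋g′ (m ∸ i)))

  ⊛-congˡ : ∀ f {g h} → g ≋ h → (f ⊛ g) ≋ (f ⊛ h)
  ⊛-congˡ f = ⊛-cong {f} {f} ≋-refl

  ⊛-congʳ : ∀ {f g} h → f ≋ g → (f ⊛ h) ≋ (g ⊛ h)
  ⊛-congʳ h f≋g = ⊛-cong {g = h} {h} f≋g ≋-refl

  scale-cong : ∀ a {f g} → f ≋ g → scale a f ≋ scale a g
  scale-cong a f≋g m = *-cong refl (f≋g m)

  scale-scale : ∀ a b f → scale a (scale b f) ≋ scale (a * b) f
  scale-scale a b f m = sym (*-assoc a b (f m))

  sumPS-cong-< : ∀ n {F G : ℕ → PS} → (∀ k → k < n → F k ≋ G k) → sumPS n F ≋ sumPS n G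
  sumPS-cong-< n F≋G m = sumTo-cong-< n (λ k k<n → F≋G k k<n m)

  ⊛-comm : ∀ f g → (f ⊛ g) ≋ (g ⊛ f)
  ⊛-comm f g m = trans (sumTo-reverse (suc m) _) (sumTo-cong-< (suc m) (λ i i<1+m →
    trans (*-comm _ _) (*-cong (reflexive (≡.cong g (ℕ.m∸[m∸n]≡n (ℕ.≤-pred i<1+m)))) refl)))

  ⊛-identityˡ : ∀ f → (const 1# ⊛ f) ≋ f
  ⊛-identityˡ f m = trans (sumTo-head m _)
    (trans (+-cong (*-identityˡ (f m)) (sumTo-0 m (λ _ → zeroˡ _))) (+-identityʳ (f m)))

  ⊛-identityʳ : ∀ f → (f ⊛ const 1#) ≋ f
  ⊛-identityʳ f = ≋-trans (⊛-comm f (const 1#)) (⊛-identityˡ f)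

  ⊛-assoc : ∀ f g h → ((f ⊛ g) ⊛ h) ≋ (f ⊛ (g ⊛ h))
  ⊛-assoc f g h m = begin
      sumTo (suc m) (λ k → sumTo (suc k) (λ i → f i * g (k ∸ i)) * h (m ∸ k))
    ≈⟨ sumTo-cong (suc m) (λ k → *-distribʳ-sumTo (suc k) (h (m ∸ k)) _) ⟩
      sumTo (suc m) (λ k → sumTo (suc k) (λ i → T i k))
    ≈⟨ sumTo-triangle (suc m) T ⟩
      sumTo (suc m) (λ i → sumTo (suc m ∸ i) (λ j → T i (i ℕ.+ j)))
    ≈⟨ sumTo-cong-< (suc m) factor-out ⟩
      sumTo (suc m) (λ i → f i * sumTo (suc (m ∸ i)) (λ j → g j * h (m ∸ i ∸ j)))
    ∎
    where
    open SetoidReasoning setoid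
    T : ℕ → ℕ → Carrier
    T i k = f i * g (k ∸ i) * h (m ∸ k)
    factor-out : ∀ i → i < suc m →
      sumTo (suc m ∸ i) (λ j → T i (i ℕ.+ j)) ≈ f i * sumTo (suc (m ∸ i)) (λ j → g j * h (m ∸ i ∸ j))
    factor-out i (s≤s i≤m) = trans (sumTo-≡ _ (ℕ.+-∸-assoc 1 i≤m))
      (trans (sumTo-cong (suc (m ∸ i)) (λ j → trans (*-assoc _ _ _)
          (*-cong refl (*-cong (reflexive (≡.cong g (ℕ.m+n∸m≡n i j)))
                               (reflexive (≡.cong h (≡.sym (ℕ.∸-+-assoc m i j))))))))
        (sym (*-distribˡ-sumTo (suc (m ∸ i)) (f i) _)))

  ⊛-scaleʳ : ∀ a f g → (f ⊛ scale a g) ≋ scale a (f ⊛ g)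
  ⊛-scaleʳ a f g m =
    trans (sumTo-cong (suc m) (λ _ → *-Props.x∙yz≈y∙xz _ _ _)) (sym (*-distribˡ-sumTo (suc m) a _))

  ⊛-scaleˡ : ∀ a f g → (scale a f ⊛ g) ≋ scale a (f ⊛ g)
  ⊛-scaleˡ a f g = begin
    scale a f ⊛ g      ≈⟨ ⊛-comm (scale a f) g ⟩
    g ⊛ scale a f      ≈⟨ ⊛-scaleʳ a g f ⟩
    scale a (g ⊛ f)    ≈⟨ scale-cong a (⊛-comm g f) ⟩
    scale a (f ⊛ g)    ∎
    where open SetoidReasoning ≋-setoid

  ⊛-distribˡ-sumPS : ∀ n f (G : ℕ → PS) → (f ⊛ sumPS n G) ≋ sumPS n (λ k → f ⊛ G k)
  ⊛-distribˡ-sumPS n f G m =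
    trans (sumTo-cong (suc m) (λ i → *-distribˡ-sumTo n (f i) _)) (sumTo-swap (suc m) n _)

  pow-cong : ∀ {f g} n → f ≋ g → pow f n ≋ pow g n
  pow-cong zero    f≋g = ≋-refl
  pow-cong (suc n) f≋g = ⊛-cong (pow-cong n f≋g) f≋g

  pow-+ : ∀ f m n → pow f (m ℕ.+ n) ≋ (pow f m ⊛ pow f n)
  pow-+ f m zero    = begin
    pow f (m ℕ.+ 0)        ≡⟨ ≡.cong (pow f) (ℕ.+-identityʳ m) ⟩
    pow f m                ≈⟨ ⊛-identityʳ (pow f m) ⟨
    pow f m ⊛ const 1#     ∎
    where open SetoidReasoning ≋-setoid
  pow-+ f m (suc n) = begin
    pow f (m ℕ.+ suc n)        ≡⟨ ≡.cong (pow f) (ℕ.+-suc m n) ⟩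
    pow f (m ℕ.+ n) ⊛ f        ≈⟨ ⊛-congʳ f (pow-+ f m n) ⟩
    (pow f m ⊛ pow f n) ⊛ f    ≈⟨ ⊛-assoc (pow f m) (pow f n) f ⟩
    pow f m ⊛ pow f (suc n)    ∎
    where open SetoidReasoning ≋-setoid

  pow-scale : ∀ a f n → pow (scale a f) n ≋ scale (a ^ n) (pow f n)
  pow-scale a f zero    m = sym (*-identityˡ _)
  pow-scale a f (suc n) = begin
    pow (scale a f) n ⊛ scale a f               ≈⟨ ⊛-congʳ (scale a f) (pow-scale a f n) ⟩
    scale (a ^ n) (pow f n) ⊛ scale a f         ≈⟨ ⊛-scaleˡ (a ^ n) (pow f n) (scale a f) ⟩
    scale (a ^ n) (pow f n ⊛ scale a f)         ≈⟨ scale-cong (a ^ n) (⊛-scaleʳ a (pow f n) f) ⟩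
    scale (a ^ n) (scale a (pow f (suc n)))     ≈⟨ scale-scale (a ^ n) a (pow f (suc n)) ⟩
    scale (a ^ n * a) (pow f (suc n))           ≈⟨ (λ m → *-cong (*-comm _ _) refl) ⟩
    scale (a ^ suc n) (pow f (suc n))           ∎
    where open SetoidReasoning ≋-setoid

  X-1≋-[1-X] : X-1 ≋ scale (- 1#) 1-X
  X-1≋-[1-X] m = sym (begin
      - 1# * (const 1# m - X m)   ≈⟨ -1*x≈-x _ ⟩
      - (const 1# m - X m)        ≈⟨ -‿distrib-+ _ _ ⟩
      - const 1# m + - - X m      ≈⟨ +-cong refl (⁻¹-involutive _) ⟩
      - const 1# m + X m          ≈⟨ +-comm _ _ ⟩
      X m - const 1# m            ∎)
    where open SetoidReasoning setoid

  [1-X]⊛-zero : ∀ f → (1-X ⊛ f) 0 ≈ f 0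
  [1-X]⊛-zero f = trans (+-identityˡ _) (trans (*-cong (x-0≈x 1#) refl) (*-identityˡ _))

  [1-X]⊛-suc : ∀ f m → (1-X ⊛ f) (suc m) ≈ f (suc m) - f m
  [1-X]⊛-suc f m = begin
      (1-X ⊛ f) (suc m)
    ≈⟨ trans (sumTo-head (suc m) _) (+-cong refl (sumTo-head m _)) ⟩
      (1# - 0#) * f (suc m) + ((0# - 1#) * f m + sumTo m (λ i → (0# - 0#) * f (m ∸ suc i)))
    ≈⟨ +-cong (trans (*-cong (x-0≈x 1#) refl) (*-identityˡ _))
              (+-cong (trans (*-cong (+-identityˡ _) refl) (-1*x≈-x _))
                      (sumTo-0 m (λ _ → trans (*-cong (x-0≈x 0#) refl) (zeroˡ _)))) ⟩
      f (suc m) + (- f m + 0#)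
    ≈⟨ +-cong refl (+-identityʳ _) ⟩
      f (suc m) - f m
    ∎
    where open SetoidReasoning setoid

module DegenerateFactorials {c ℓ : Level} (R : CommutativeRing c ℓ) (lam : CommutativeRing.Carrier R) where
  open RingLemmas R
  open Series R using (fromℕ; sumTo; falling; rising)
  open FiniteSums R
  open SetoidReasoning setoid

  falling-congˡ : ∀ n {x y} → x ≈ y → falling x lam n ≈ falling y lam n
  falling-congˡ zero    x≈y = refl
  falling-congˡ (suc n) x≈y = *-cong (falling-congˡ n x≈y) (+-cong x≈y refl)

  falling-zero : ∀ n → falling 0# lam (suc n) ≈ 0#
  falling-zero zero    = trans (*-identityˡ _) (trans (+-identityˡ _) (trans (-‿cong (zeroˡ lam)) ε⁻¹≈ε))
  falling-zero (suc n) = trans (*-cong (falling-zero n) refl) (zeroˡ _)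

  falling-minus-one : ∀ n → falling (- 1#) lam n ≈ (- 1#) ^ n * rising 1# lam n
  falling-minus-one zero    = sym (*-identityˡ 1#)
  falling-minus-one (suc n) = begin
      falling (- 1#) lam n * (- 1# - fromℕ n * lam)
    ≈⟨ *-cong (falling-minus-one n) (sym (trans (-1*x≈-x _) (-‿distrib-+ _ _))) ⟩
      ((- 1#) ^ n * rising 1# lam n) * (- 1# * (1# + fromℕ n * lam))
    ≈⟨ *-Props.interchange _ _ _ _ ⟩
      ((- 1#) ^ n * - 1#) * (rising 1# lam n * (1# + fromℕ n * lam))
    ≈⟨ *-cong (*-comm _ _) refl ⟩
      (- 1#) ^ suc n * rising 1# lam (suc n)
    ∎

  -- The last factor x + y - nλ splits as (x - kλ) + (y - (n-k)λ), extending either factorial.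
  falling-*-step : ∀ x y {k n} → k ≤ n →
    falling x lam k * falling y lam (n ∸ k) * (x + y - fromℕ n * lam)
      ≈ falling x lam (suc k) * falling y lam (n ∸ k) + falling x lam k * falling y lam (suc n ∸ k)
  falling-*-step x y {k} {n} k≤n = begin
      [x]ₖ * [y]ₙ₋ₖ * (x + y - fromℕ n * lam)
    ≈⟨ *-cong refl split ⟩
      [x]ₖ * [y]ₙ₋ₖ * ((x - fromℕ k * lam) + (y - fromℕ (n ∸ k) * lam))
    ≈⟨ distribˡ _ _ _ ⟩
      [x]ₖ * [y]ₙ₋ₖ * (x - fromℕ k * lam) + [x]ₖ * [y]ₙ₋ₖ * (y - fromℕ (n ∸ k) * lam)
    ≈⟨ +-cong (*-Props.xy∙z≈xz∙y _ _ _) (*-assoc _ _ _) ⟩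
      falling x lam (suc k) * [y]ₙ₋ₖ + [x]ₖ * falling y lam (suc (n ∸ k))
    ≈⟨ +-cong refl (*-cong refl (reflexive (≡.cong (falling y lam) (≡.sym (ℕ.+-∸-assoc 1 k≤n))))) ⟩
      falling x lam (suc k) * [y]ₙ₋ₖ + [x]ₖ * falling y lam (suc n ∸ k)
    ∎
    where
    [x]ₖ [y]ₙ₋ₖ : Carrier
    [x]ₖ = falling x lam k
    [y]ₙ₋ₖ = falling y lam (n ∸ k)
    split : x + y - fromℕ n * lam ≈ (x - fromℕ k * lam) + (y - fromℕ (n ∸ k) * lam)
    split = begin
        x + y - fromℕ n * lam
      ≈⟨ +-cong refl (-‿cong (*-cong (reflexive (≡.cong fromℕ (≡.sym (ℕ.m+[n∸m]≡n k≤n)))) refl)) ⟩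
        x + y - fromℕ (k ℕ.+ (n ∸ k)) * lam
      ≈⟨ +-cong refl (-‿cong (trans (*-cong (fromℕ-+ k (n ∸ k)) refl) (distribʳ _ _ _))) ⟩
        x + y - (fromℕ k * lam + fromℕ (n ∸ k) * lam)
      ≈⟨ +-cong refl (-‿distrib-+ _ _) ⟩
        x + y + (- (fromℕ k * lam) + - (fromℕ (n ∸ k) * lam))
      ≈⟨ +-Props.interchange _ _ _ _ ⟩
        (x - fromℕ k * lam) + (y - fromℕ (n ∸ k) * lam)
      ∎

  binomialTerm : Carrier → Carrier → ℕ → ℕ → Carrier
  binomialTerm x y n k = fromℕ (n C k) * (falling x lam k * falling y lam (n ∸ k))

  falling-binomial : ∀ n x y → falling (x + y) lam n ≈ sumTo (suc n) (binomialTerm x y n)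
  falling-binomial zero    x y =
    sym (trans (+-identityˡ _) (trans (*-cong fromℕ-1 (*-identityˡ 1#)) (*-identityˡ 1#)))
  falling-binomial (suc n) x y = begin
      falling (x + y) lam n * (x + y - fromℕ n * lam)
    ≈⟨ *-cong (falling-binomial n x y) refl ⟩
      sumTo (suc n) (binomialTerm x y n) * (x + y - fromℕ n * lam)
    ≈⟨ *-distribʳ-sumTo (suc n) _ _ ⟩
      sumTo (suc n) (λ k → binomialTerm x y n k * (x + y - fromℕ n * lam))
    ≈⟨ sumTo-cong-< (suc n) (λ k k<1+n → trans (*-assoc _ _ _)
         (trans (*-cong refl (falling-*-step x y (ℕ.≤-pred k<1+n))) (distribˡ _ _ _))) ⟩
      sumTo (suc n) (λ k → U k + V k)
    ≈⟨ sumTo-distrib-+ (suc n) U V ⟩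
      sumTo (suc n) U + sumTo (suc n) V
    ≈⟨ +-cong refl (sumTo-head n V) ⟩
      sumTo (suc n) U + (V 0 + sumTo n (λ k → V (suc k)))
    ≈⟨ +-Props.x∙yz≈y∙xz _ _ _ ⟩
      V 0 + (sumTo (suc n) U + sumTo n (λ k → V (suc k)))
    ≈⟨ +-cong refl (+-cong refl (sym (trans (+-cong refl V[1+n]≈0) (+-identityʳ _)))) ⟩
      V 0 + (sumTo (suc n) U + sumTo (suc n) (λ k → V (suc k)))
    ≈⟨ +-cong refl (sym (sumTo-distrib-+ (suc n) U (λ k → V (suc k)))) ⟩
      V 0 + sumTo (suc n) (λ k → U k + V (suc k))
    ≈⟨ +-cong refl (sumTo-cong (suc n) pascal) ⟩
      binomialTerm x y (suc n) 0 + sumTo (suc n) (λ k → binomialTerm x y (suc n) (suc k))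
    ≈⟨ sumTo-head (suc n) (binomialTerm x y (suc n)) ⟨
      sumTo (suc (suc n)) (binomialTerm x y (suc n))
    ∎
    where
    U V : ℕ → Carrier
    U k = fromℕ (n C k) * (falling x lam (suc k) * falling y lam (n ∸ k))
    V k = fromℕ (n C k) * (falling x lam k * falling y lam (suc n ∸ k))
    V[1+n]≈0 : V (suc n) ≈ 0#
    V[1+n]≈0 = trans (*-cong (reflexive (≡.cong fromℕ (k>n⇒nCk≡0 (ℕ.n<1+n n)))) refl) (zeroˡ _)
    pascal : ∀ k → U k + V (suc k) ≈ binomialTerm x y (suc n) (suc k)
    pascal k = trans (sym (distribʳ _ _ _)) (*-cong (trans (sym (fromℕ-+ (n C k) (n C suc k)))
      (reflexive (≡.cong fromℕ (nCk+nC[k+1]≡[n+1]C[k+1] n k)))) refl)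

  -- The degenerate binomial theorem with y = -1, whose top term is (1+x)_{n,λ} itself.
  falling-suc-difference : ∀ n x →
    falling (1# + x) lam n - falling x lam n
      ≈ sumTo n (λ k → (fromℕ (n C k) * rising 1# lam (n ∸ k)) * (- 1#) ^ (n ∸ k ∸ 1) * falling (1# + x) lam k)
  falling-suc-difference n x = begin
      [z]ₙ - falling x lam n
    ≈⟨ +-cong refl (-‿cong (trans (falling-congˡ n x≈z-1) (falling-binomial n z (- 1#)))) ⟩
      [z]ₙ - (sumTo n T + T n)
    ≈⟨ +-cong refl (-‿cong (+-cong refl Tₙ≈[z]ₙ)) ⟩
      [z]ₙ - (sumTo n T + [z]ₙ)
    ≈⟨ +-cong refl (-‿distrib-+ _ _) ⟩
      [z]ₙ + (- sumTo n T + - [z]ₙ)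
    ≈⟨ +-Props.x∙yz≈y∙xz _ _ _ ⟩
      - sumTo n T + ([z]ₙ - [z]ₙ)
    ≈⟨ trans (+-cong refl (-‿inverseʳ _)) (+-identityʳ _) ⟩
      - sumTo n T
    ≈⟨ -‿distrib-sumTo n T ⟩
      sumTo n (λ k → - T k)
    ≈⟨ sumTo-cong-< n (λ k k<n → sign-flip (n∸k≡suc[n∸k∸1] k<n)) ⟩
      sumTo n (λ k → (fromℕ (n C k) * rising 1# lam (n ∸ k)) * (- 1#) ^ (n ∸ k ∸ 1) * falling z lam k)
    ∎
    where
    z [z]ₙ : Carrier
    z = 1# + x
    [z]ₙ = falling z lam n
    T : ℕ → Carrier
    T = binomialTerm z (- 1#) n
    x≈z-1 : x ≈ z - 1#
    x≈z-1 = sym (trans (+-cong (+-comm 1# x) refl)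
      (trans (+-assoc _ _ _) (trans (+-cong refl (-‿inverseʳ 1#)) (+-identityʳ x))))
    Tₙ≈[z]ₙ : T n ≈ [z]ₙ
    Tₙ≈[z]ₙ = trans (*-cong (trans (reflexive (≡.cong fromℕ (nCn≡1 n))) fromℕ-1)
                              (*-cong refl (reflexive (≡.cong (falling (- 1#) lam) (ℕ.n∸n≡0 n)))))
                    (trans (*-identityˡ _) (*-identityʳ _))
    sign-flip : ∀ {a w d e} → d ≡ suc e →
      - (a * (w * falling (- 1#) lam d)) ≈ (a * rising 1# lam d) * (- 1#) ^ e * w
    sign-flip {a} {w} {suc e} ≡.refl = begin
        - (a * (w * falling (- 1#) lam (suc e)))
      ≈⟨ -‿cong (*-cong refl (*-cong refl (falling-minus-one (suc e)))) ⟩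
        - (a * (w * ((- 1# * p) * r)))
      ≈⟨ -‿cong (*-cong refl (*-cong refl (trans (*-assoc _ _ _) (-1*x≈-x _)))) ⟩
        - (a * (w * - (p * r)))
      ≈⟨ -‿cong (trans (*-cong refl (sym (-‿distribʳ-* w (p * r)))) (sym (-‿distribʳ-* a _))) ⟩
        - - (a * (w * (p * r)))
      ≈⟨ ⁻¹-involutive _ ⟩
        a * (w * (p * r))
      ≈⟨ *-cong refl (*-comm _ _) ⟩
        a * ((p * r) * w)
      ≈⟨ trans (sym (*-assoc _ _ _)) (*-cong (trans (*-cong refl (*-comm p r)) (sym (*-assoc _ _ _))) refl) ⟩
        (a * r) * p * w
      ∎
      where
      p r : Carrier
      p = (- 1#) ^ e
      r = rising 1# lam (suc e)

module DegenerateEulerian {c ℓ : Level} (R : CommutativeRing c ℓ) (lam : CommutativeRing.Carrier R) where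
  open RingLemmas R
  open Series R
  open PowerSeries R
  open DegenerateFactorials R lam
  open SetoidReasoning ≋-setoid

  [1-X]⊛fallingSeries : ∀ {n} → 1 ≤ n →
    (1-X ⊛ fallingSeries lam n)
      ≋ sumPS n (λ k → scale ((fromℕ (n C k) * rising 1# lam (n ∸ k)) * (- 1#) ^ (n ∸ k ∸ 1))
                             (fallingSeries lam k))
  [1-X]⊛fallingSeries {suc n} _ m = trans (difference m) (falling-suc-difference (suc n) (fromℕ m))
    where
    difference : ∀ m → (1-X ⊛ fallingSeries lam (suc n)) m
                         ≈ falling (1# + fromℕ m) lam (suc n) - falling (fromℕ m) lam (suc n)
    difference zero    = trans ([1-X]⊛-zero (fallingSeries lam (suc n)))
      (sym (trans (+-cong refl (-‿cong (falling-zero n))) (x-0≈x _)))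
    difference (suc m) = [1-X]⊛-suc (fallingSeries lam (suc n)) m

  A⊛pow[X-1] : ∀ {k n} → k < n →
    (A lam k ⊛ pow X-1 (n ∸ k ∸ 1)) ≋ scale ((- 1#) ^ (n ∸ k ∸ 1)) (pow 1-X n ⊛ fallingSeries lam k)
  A⊛pow[X-1] {k} {n} k<n = begin
      (pow 1-X (suc k) ⊛ F) ⊛ pow X-1 e
    ≈⟨ ⊛-congˡ (pow 1-X (suc k) ⊛ F) (≋-trans (pow-cong e X-1≋-[1-X]) (pow-scale (- 1#) 1-X e)) ⟩
      (pow 1-X (suc k) ⊛ F) ⊛ scale ((- 1#) ^ e) (pow 1-X e)
    ≈⟨ ⊛-scaleʳ ((- 1#) ^ e) (pow 1-X (suc k) ⊛ F) (pow 1-X e) ⟩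
      scale ((- 1#) ^ e) ((pow 1-X (suc k) ⊛ F) ⊛ pow 1-X e)
    ≈⟨ scale-cong ((- 1#) ^ e) collect-powers ⟩
      scale ((- 1#) ^ e) (pow 1-X n ⊛ F)
    ∎
    where
    e : ℕ
    e = n ∸ k ∸ 1
    F : PS
    F = fallingSeries lam k
    suc[k+e]≡n : suc k ℕ.+ e ≡ n
    suc[k+e]≡n = ≡.trans (≡.sym (ℕ.+-suc k e))
      (≡.trans (≡.cong (k ℕ.+_) (≡.sym (n∸k≡suc[n∸k∸1] k<n))) (ℕ.m+[n∸m]≡n (ℕ.<⇒≤ k<n)))
    collect-powers : ((pow 1-X (suc k) ⊛ F) ⊛ pow 1-X e) ≋ (pow 1-X n ⊛ F)
    collect-powers = begin
      (pow 1-X (suc k) ⊛ F) ⊛ pow 1-X e      ≈⟨ ⊛-assoc (pow 1-X (suc k)) F (pow 1-X e) ⟩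
      pow 1-X (suc k) ⊛ (F ⊛ pow 1-X e)      ≈⟨ ⊛-congˡ (pow 1-X (suc k)) (⊛-comm F (pow 1-X e)) ⟩
      pow 1-X (suc k) ⊛ (pow 1-X e ⊛ F)      ≈⟨ ⊛-assoc (pow 1-X (suc k)) (pow 1-X e) F ⟨
      (pow 1-X (suc k) ⊛ pow 1-X e) ⊛ F      ≈⟨ ⊛-congʳ F (pow-+ 1-X (suc k) e) ⟨
      pow 1-X (suc k ℕ.+ e) ⊛ F              ≡⟨ ≡.cong (λ m → pow 1-X m ⊛ F) suc[k+e]≡n ⟩
      pow 1-X n ⊛ F                          ∎

theorem10 : ∀ {c ℓ : Level} (R : CommutativeRing c ℓ) (lam : CommutativeRing.Carrier R)
    (n : ℕ) → 1 ≤ n →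
    Series._≋_ R (Series.A R lam n) (Series.rhs R lam n)
theorem10 R lam n 1≤n = begin
    pow 1-X (suc n) ⊛ F n
  ≈⟨ ⊛-assoc (pow 1-X n) 1-X (F n) ⟩
    pow 1-X n ⊛ (1-X ⊛ F n)
  ≈⟨ ⊛-congˡ (pow 1-X n) ([1-X]⊛fallingSeries 1≤n) ⟩
    pow 1-X n ⊛ sumPS n (λ k → scale (a k * s k) (F k))
  ≈⟨ ⊛-distribˡ-sumPS n (pow 1-X n) (λ k → scale (a k * s k) (F k)) ⟩
    sumPS n (λ k → pow 1-X n ⊛ scale (a k * s k) (F k))
  ≈⟨ sumPS-cong-< n term ⟩
    rhs lam n
  ∎
  where
  open RingLemmas R
  open Series R
  open PowerSeries R
  open DegenerateEulerian R lam
  open SetoidReasoning ≋-setoid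
  F : ℕ → PS
  F = fallingSeries lam
  a s : ℕ → Carrier
  a k = fromℕ (n C k) * rising 1# lam (n ∸ k)
  s k = (- 1#) ^ (n ∸ k ∸ 1)
  term : ∀ k → k < n →
    (pow 1-X n ⊛ scale (a k * s k) (F k)) ≋ scale (a k) (A lam k ⊛ pow X-1 (n ∸ k ∸ 1))
  term k k<n = begin
    pow 1-X n ⊛ scale (a k * s k) (F k)          ≈⟨ ⊛-scaleʳ (a k * s k) (pow 1-X n) (F k) ⟩
    scale (a k * s k) (pow 1-X n ⊛ F k)          ≈⟨ scale-scale (a k) (s k) (pow 1-X n ⊛ F k) ⟨
    scale (a k) (scale (s k) (pow 1-X n ⊛ F k))  ≈⟨ scale-cong (a k) (A⊛pow[X-1] k<n) ⟨
    scale (a k) (A lam k ⊛ pow X-1 (n ∸ k ∸ 1))  ∎
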